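{- Let $G$ be a finite, simple, undirected, connected graph, let $G_b$ be its base graph, and let $L(G)$ be the set of leaves of $G$. If $S$ is an MEG-set of $G_b$, then $S\cup L(G)$ is an MEG-set of $G$.
   Context: The base graph $G_b$ of $G$ is the graph obtained from $G$ by iteratively removing vertices of degree $1$ until none remain. A leaf is a vertex of degree $1$. Two vertices $x,y$ of a graph $H$ monitor an edge $e$ if $e$ belongs to all shortest paths between $x$ and $y$ in $H$; a set $S\subseteq V(H)$ is an MEG-set of $H$ if for every edge $e$ of $H$ some pair $x,y\in S$ monitors $e$ in $H$. -}

module Defs where

open import Data.Bool using (Bool; true; false)
open import Data.Nat using (ℕ; zero; suc; _≤_; _≡ᵇ_)
open import Data.Fin using (Fin)
open import Data.Fin.Subset using (Subset; _∈_; _⊆_; _∩_; _∪_; _─_; ⁅_⁆; ⊤; ∣_∣)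
open import Data.Vec using (tabulate)
open import Data.Product using (Σ; ∃; _×_; _,_)
open import Data.Empty using (⊥)
open import Relation.Binary.PropositionalEquality using (_≡_)

record Graph (n : ℕ) : Set where
  field
    E      : Fin n → Fin n → Bool
    sym    : ∀ u v → E u v ≡ E v u
    irrefl : ∀ u → E u u ≡ false
open Graph public

module _ {n : ℕ} (G : Graph n) where

  -- Walks in the subgraph of G induced by the vertex set W.
  data Walk (W : Subset n) : Fin n → Fin n → Set where
    []  : ∀ {x} → x ∈ W → Walk W x x
    _∷_ : ∀ {x y z} → (x ∈ W) × (E G x y ≡ true) → Walk W y z → Walk W x z

  len : ∀ {W x y} → Walk W x y → ℕ
  len ([] _)  = zero
  len (_ ∷ p) = suc (len p)

  data EdgeIn {W : Subset n} (u v : Fin n) : ∀ {x y} → Walk W x y → Set where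
    here-uv : ∀ {z} {h : (u ∈ W) × (E G u v ≡ true)} {p : Walk W v z} → EdgeIn u v (h ∷ p)
    here-vu : ∀ {z} {h : (v ∈ W) × (E G v u ≡ true)} {p : Walk W u z} → EdgeIn u v (h ∷ p)
    there   : ∀ {x y z} {h : (x ∈ W) × (E G x y ≡ true)} {p : Walk W y z}
              → EdgeIn u v p → EdgeIn u v (h ∷ p)

  IsShortest : ∀ {W x y} → Walk W x y → Set
  IsShortest {W} {x} {y} p = ∀ (q : Walk W x y) → len p ≤ len q

  Monitors : Subset n → Fin n → Fin n → Fin n → Fin n → Set
  Monitors W x y u v = ∀ (p : Walk W x y) → IsShortest p → EdgeIn u v p

  IsEdgeIn : Subset n → Fin n → Fin n → Set
  IsEdgeIn W u v = (u ∈ W) × (v ∈ W) × (E G u v ≡ true)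

  IsMEGSet : Subset n → Subset n → Set
  IsMEGSet W S = S ⊆ W × (∀ u v → IsEdgeIn W u v →
                   Σ (Fin n) λ x → Σ (Fin n) λ y → x ∈ S × y ∈ S × Monitors W x y u v)

  Connected : Set
  Connected = ∀ x y → Walk ⊤ x y

  nbrs : Fin n → Subset n
  nbrs u = tabulate (E G u)

  deg : Subset n → Fin n → ℕ
  deg W u = ∣ W ∩ nbrs u ∣

  leaves : Subset n
  leaves = tabulate (λ v → deg ⊤ v ≡ᵇ 1)

  data LeafRemoval : Subset n → Subset n → Set where
    done : ∀ {W} → LeafRemoval W W
    step : ∀ {W W'} v → v ∈ W → deg W v ≡ 1 → LeafRemoval (W ─ ⁅ v ⁆) W' → LeafRemoval W W'

  IsBaseSet : Subset n → Set
  IsBaseSet B = LeafRemoval ⊤ B × (∀ v → v ∈ B → deg B v ≡ 1 → ⊥)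

{-# OPTIONS --safe #-}
-- Follow the leaf-removal sequence V(G) = W₀ ⟶ W₁ ⟶ … ⟶ B backwards, maintaining that
-- S together with the leaves of G[Wᵢ] is an MEG-set of G[Wᵢ]. When a leaf v with unique
-- neighbour w is put back, no shortest path between old vertices enters v (it would have to
-- run w v w), so old monitors keep monitoring; the new edge vw lies on every path from v;
-- and a monitor w that stops being a leaf can be replaced by v, because every shortest path
-- from v is vw followed by a shortest path from w.
module Submission where

open import Defs hiding (sym)
open import Data.Nat using (ℕ; suc; _≤_; _<_; _≡ᵇ_; z≤n; s≤s)
open import Data.Nat.Properties using (≤-antisym; ≤-pred; ≤-trans; <⇒≱; n≤1+n)
open import Data.Bool using (Bool; true)
open import Data.Fin using (Fin; _≟_)
open import Data.Fin.Subset
  using (Subset; _∈_; _∉_; _⊆_; _∩_; _∪_; _─_; _-_; ⁅_⁆; ⊤; ∣_∣; Nonempty; inside)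
open import Data.Fin.Subset.Properties
  using (nonempty?; Empty-unique; ∈⊤; ∣⊥∣≡0; x∈⁅x⁆; ∣⁅x⁆∣≡1; p⊆q⇒∣p∣≤∣q∣; x∈p∩q⁺; x∈p∩q⁻;
         x∈p∪q⁺; p─q⊆p; x∈p∧x≢y⇒x∈p-y; x∈p⇒∣p-x∣<∣p∣)
open import Data.Vec using (_∷_; here; there; tabulate)
open import Data.Vec.Properties using (lookup∘tabulate; lookup⇒[]=; []=⇒lookup)
open import Data.Product using (Σ; _×_; _,_; proj₁; proj₂)
open import Data.Sum using (_⊎_; inj₁; inj₂)
open import Data.Empty using (⊥-elim)
open import Function using (_∘_)
open import Relation.Nullary using (¬_; yes; no; contradiction)
open import Relation.Binary.PropositionalEquality
  using (_≡_; _≢_; refl; sym; trans; cong; subst; subst₂)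

x∈tabulate⁺ : ∀ {n} (f : Fin n → Bool) {x} → f x ≡ true → x ∈ tabulate f
x∈tabulate⁺ f {x} fx = lookup⇒[]= x (tabulate f) (trans (lookup∘tabulate f x) fx)

x∈tabulate⁻ : ∀ {n} (f : Fin n → Bool) {x} → x ∈ tabulate f → f x ≡ true
x∈tabulate⁻ f {x} x∈ = trans (sym (lookup∘tabulate f x)) ([]=⇒lookup x∈)

x∈p─q⇒x∉q : ∀ {n} {x : Fin n} (p q : Subset n) → x ∈ p ─ q → x ∉ q
x∈p─q⇒x∉q (_ ∷ p) (inside ∷ q) () here
x∈p─q⇒x∉q (_ ∷ p) (_ ∷ q) (there x∈) (there x∈q) = x∈p─q⇒x∉q p q x∈ x∈q

x∈p-y⇒x≢y : ∀ {n} {p : Subset n} {x y} → x ∈ p - y → x ≢ y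
x∈p-y⇒x≢y {p = p} {y = y} x∈ refl = x∈p─q⇒x∉q p ⁅ y ⁆ x∈ (x∈⁅x⁆ y)

x∈p⇒0<∣p∣ : ∀ {n} {p : Subset n} {x} → x ∈ p → 0 < ∣ p ∣
x∈p⇒0<∣p∣ x∈p = ≤-trans (s≤s z≤n) (x∈p⇒∣p-x∣<∣p∣ x∈p)

∣p∣≡1⇒Nonempty : ∀ {n} {p : Subset n} → ∣ p ∣ ≡ 1 → Nonempty p
∣p∣≡1⇒Nonempty {n} {p} ∣p∣≡1 with nonempty? p
... | yes ne = ne
... | no ¬ne =
  contradiction (trans (sym ∣p∣≡1) (trans (cong ∣_∣ (Empty-unique ¬ne)) (∣⊥∣≡0 n))) λ ()

∣p∣≡1⇒x≡y : ∀ {n} {p : Subset n} {x y} → ∣ p ∣ ≡ 1 → x ∈ p → y ∈ p → x ≡ y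
∣p∣≡1⇒x≡y {p = p} {x} {y} ∣p∣≡1 x∈p y∈p with x ≟ y
... | yes x≡y = x≡y
... | no x≢y = contradiction (x∈p⇒0<∣p∣ (x∈p∧x≢y⇒x∈p-y y∈p (x≢y ∘ sym)))
                             (<⇒≱ (subst (∣ p - x ∣ <_) ∣p∣≡1 (x∈p⇒∣p-x∣<∣p∣ x∈p)))

x∈p⊆⁅x⁆⇒∣p∣≡1 : ∀ {n} {p : Subset n} {x} → x ∈ p → p ⊆ ⁅ x ⁆ → ∣ p ∣ ≡ 1
x∈p⊆⁅x⁆⇒∣p∣≡1 {x = x} x∈p p⊆⁅x⁆ =
  ≤-antisym (subst (_ ≤_) (∣⁅x⁆∣≡1 x) (p⊆q⇒∣p∣≤∣q∣ p⊆⁅x⁆)) (x∈p⇒0<∣p∣ x∈p)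

module _ {n : ℕ} (G : Graph n) where

  ∈∩nbrs⁺ : ∀ {W u z} → z ∈ W → E G u z ≡ true → z ∈ W ∩ nbrs G u
  ∈∩nbrs⁺ {u = u} z∈W uz = x∈p∩q⁺ (z∈W , x∈tabulate⁺ (E G u) uz)

  ∈∩nbrs⁻ : ∀ {W u z} → z ∈ W ∩ nbrs G u → z ∈ W × E G u z ≡ true
  ∈∩nbrs⁻ {W} {u} z∈ with x∈p∩q⁻ W (nbrs G u) z∈
  ... | z∈W , z∈nbrs = z∈W , x∈tabulate⁻ (E G u) z∈nbrs

  head∈ : ∀ {W x y} → Walk G W x y → x ∈ W
  head∈ ([] x∈W)       = x∈W
  head∈ ((x∈W , _) ∷ _) = x∈W

  weaken : ∀ {W W'} → W ⊆ W' → ∀ {x y} → Walk G W x y → Walk G W' x y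
  weaken W⊆W' ([] x∈W)        = [] (W⊆W' x∈W)
  weaken W⊆W' ((x∈W , xy) ∷ p) = (W⊆W' x∈W , xy) ∷ weaken W⊆W' p

  len-weaken : ∀ {W W'} (W⊆W' : W ⊆ W') {x y} (p : Walk G W x y) →
               len G (weaken W⊆W' p) ≡ len G p
  len-weaken W⊆W' ([] _)  = refl
  len-weaken W⊆W' (_ ∷ p) = cong suc (len-weaken W⊆W' p)

  _⊆ᴱ_ : ∀ {W W' x y x' y'} → Walk G W x y → Walk G W' x' y' → Set
  p ⊆ᴱ q = ∀ {a b} → EdgeIn G a b p → EdgeIn G a b q

  ∷-⊆ᴱ : ∀ {W W' x y z z'} {h : x ∈ W × E G x y ≡ true} {h' : x ∈ W' × E G x y ≡ true}
           {p : Walk G W y z} {q : Walk G W' y z'} → p ⊆ᴱ q → (h ∷ p) ⊆ᴱ (h' ∷ q)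
  ∷-⊆ᴱ p⊆q here-uv    = here-uv
  ∷-⊆ᴱ p⊆q here-vu    = here-vu
  ∷-⊆ᴱ p⊆q (there e) = there (p⊆q e)

  HasShorter : ∀ {W x y} → Walk G W x y → Set
  HasShorter {W} {x} {y} p = Σ (Walk G W x y) λ q → len G q < len G p

  IsShortest⇒¬HasShorter : ∀ {W x y} {p : Walk G W x y} → IsShortest G p → ¬ HasShorter p
  IsShortest⇒¬HasShorter shortest (q , q<p) = <⇒≱ q<p (shortest q)

  ¬Monitors-loop : ∀ {W x a b} → x ∈ W → ¬ Monitors G W x x a b
  ¬Monitors-loop x∈W M with M ([] x∈W) (λ _ → z≤n)
  ... | ()

  IsLeaf : Subset n → Fin n → Set
  IsLeaf W x = x ∈ W × deg G W x ≡ 1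

  Anchor : Subset n → Subset n → Fin n → Set
  Anchor S W x = x ∈ S ⊎ IsLeaf W x

  MonitoredBy : Subset n → (Fin n → Set) → Set
  MonitoredBy W Q = ∀ u v → IsEdgeIn G W u v →
    Σ (Fin n) λ x → Σ (Fin n) λ y → Q x × Q y × Monitors G W x y u v

  MonitoredBy-map : ∀ {W} {Q Q' : Fin n → Set} → (∀ {x} → Q x → Q' x) →
                    MonitoredBy W Q → MonitoredBy W Q'
  MonitoredBy-map Q⇒Q' monitored u v uv with monitored u v uv
  ... | x , y , qx , qy , M = x , y , Q⇒Q' qx , Q⇒Q' qy , M

  module LeafDeletion (W : Subset n) {v : Fin n} (v∈W : v ∈ W) (leaf : deg G W v ≡ 1) where

    W' : Subset n
    W' = W - v

    W'⊆W : W' ⊆ W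
    W'⊆W = p─q⊆p W ⁅ v ⁆

    ∈W' : ∀ {z} → z ∈ W → z ≢ v → z ∈ W'
    ∈W' = x∈p∧x≢y⇒x∈p-y

    ∈W'⇒≢v : ∀ {z} → z ∈ W' → z ≢ v
    ∈W'⇒≢v = x∈p-y⇒x≢y

    w : Fin n
    w = proj₁ (∣p∣≡1⇒Nonempty {p = W ∩ nbrs G v} leaf)

    w∈W∩nbrs : w ∈ W ∩ nbrs G v
    w∈W∩nbrs = proj₂ (∣p∣≡1⇒Nonempty {p = W ∩ nbrs G v} leaf)

    w∈W : w ∈ W
    w∈W = proj₁ (∈∩nbrs⁻ w∈W∩nbrs)

    vw : E G v w ≡ true
    vw = proj₂ (∈∩nbrs⁻ w∈W∩nbrs)

    wv : E G w v ≡ true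
    wv = trans (Graph.sym G w v) vw

    w-unique : ∀ {z} → z ∈ W → E G v z ≡ true → z ≡ w
    w-unique z∈W vz = ∣p∣≡1⇒x≡y {p = W ∩ nbrs G v} leaf (∈∩nbrs⁺ z∈W vz) w∈W∩nbrs

    w-unique′ : ∀ {z} → z ∈ W → E G z v ≡ true → z ≡ w
    w-unique′ {z} z∈W zv = w-unique z∈W (trans (Graph.sym G v z) zv)

    w≢v : w ≢ v
    w≢v w≡v with trans (sym vw) (trans (cong (E G v) w≡v) (irrefl G v))
    ... | ()

    w∈W' : w ∈ W'
    w∈W' = ∈W' w∈W w≢v

    avoid-leaf : ∀ {x y} (p : Walk G W x y) → x ≢ v → y ≢ v →
      HasShorter p ⊎ (Σ (Walk G W' x y) λ p' → len G p' ≡ len G p × p' ⊆ᴱ p)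
    avoid-leaf ([] x∈W) x≢v y≢v = inj₂ ([] (∈W' x∈W x≢v) , refl , λ ())
    avoid-leaf (_∷_ {y = x₁} (x∈W , xx₁) p) x≢v y≢v with x₁ ≟ v
    avoid-leaf (_ ∷ [] _) x≢v y≢v | yes refl = ⊥-elim (y≢v refl)
    avoid-leaf ((x∈W , xv) ∷ ((_ , vx₂) ∷ p)) x≢v y≢v | yes refl
      with w-unique′ x∈W xv | w-unique (head∈ p) vx₂
    ... | refl | refl = inj₁ (p , n≤1+n _)
    avoid-leaf ((x∈W , xx₁) ∷ p) x≢v y≢v | no x₁≢v with avoid-leaf p x₁≢v y≢v
    ... | inj₁ (q , q<p)        = inj₁ ((x∈W , xx₁) ∷ q , s≤s q<p)
    ... | inj₂ (p' , len≡ , p'⊆p) = inj₂ ((∈W' x∈W x≢v , xx₁) ∷ p' , cong suc len≡ , ∷-⊆ᴱ p'⊆p)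

    avoid-leaf-end : ∀ {x} (p : Walk G W x v) → x ≢ v →
      HasShorter p ⊎ (Σ (Walk G W' x w) λ p' → suc (len G p') ≡ len G p × p' ⊆ᴱ p)
    avoid-leaf-end ([] _) x≢v = ⊥-elim (x≢v refl)
    avoid-leaf-end (_∷_ {y = x₁} (x∈W , xx₁) p) x≢v with x₁ ≟ v
    avoid-leaf-end ((x∈W , xv) ∷ [] _) x≢v | yes refl with w-unique′ x∈W xv
    ... | refl = inj₂ ([] w∈W' , refl , λ ())
    avoid-leaf-end ((x∈W , xv) ∷ (_ ∷ _)) x≢v | yes refl =
      inj₁ ((x∈W , xv) ∷ [] v∈W , s≤s (s≤s z≤n))
    avoid-leaf-end ((x∈W , xx₁) ∷ p) x≢v | no x₁≢v with avoid-leaf-end p x₁≢v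
    ... | inj₁ (q , q<p)        = inj₁ ((x∈W , xx₁) ∷ q , s≤s q<p)
    ... | inj₂ (p' , len≡ , p'⊆p) = inj₂ ((∈W' x∈W x≢v , xx₁) ∷ p' , cong suc len≡ , ∷-⊆ᴱ p'⊆p)

    _▹v : ∀ {x} → Walk G W x w → Walk G W x v
    [] w∈W ▹v = (w∈W , wv) ∷ [] v∈W
    (h ∷ p) ▹v = h ∷ (p ▹v)

    len-▹v : ∀ {x} (p : Walk G W x w) → len G (p ▹v) ≡ suc (len G p)
    len-▹v ([] _)  = refl
    len-▹v (_ ∷ p) = cong suc (len-▹v p)

    leaf-edge-first : ∀ {t} → t ≢ v → (p : Walk G W v t) → EdgeIn G v w p × EdgeIn G w v p
    leaf-edge-first t≢v ([] _) = ⊥-elim (t≢v refl)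
    leaf-edge-first t≢v ((_ , vx₁) ∷ p) with w-unique (head∈ p) vx₁
    ... | refl = here-uv , here-vu

    Monitors-lift : ∀ {x y a b} → x ≢ v → y ≢ v → Monitors G W' x y a b → Monitors G W x y a b
    Monitors-lift x≢v y≢v M p shortest with avoid-leaf p x≢v y≢v
    ... | inj₁ shorter = ⊥-elim (IsShortest⇒¬HasShorter shortest shorter)
    ... | inj₂ (p' , len≡ , p'⊆p) = p'⊆p (M p' shortest')
      where
        shortest' : IsShortest G p'
        shortest' q = subst₂ _≤_ (sym len≡) (len-weaken W'⊆W q) (shortest (weaken W'⊆W q))

    Monitors-from-leaf : ∀ {y a b} → y ≢ v → Monitors G W' w y a b → Monitors G W v y a b
    Monitors-from-leaf y≢v M ([] _) shortest = ⊥-elim (y≢v refl)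
    Monitors-from-leaf y≢v M ((v∈W , vx₁) ∷ p) shortest with w-unique (head∈ p) vx₁
    ... | refl = there (Monitors-lift w≢v y≢v M p λ q → ≤-pred (shortest ((v∈W , vx₁) ∷ q)))

    Monitors-to-leaf : ∀ {x a b} → x ≢ v → Monitors G W' x w a b → Monitors G W x v a b
    Monitors-to-leaf x≢v M p shortest with avoid-leaf-end p x≢v
    ... | inj₁ shorter = ⊥-elim (IsShortest⇒¬HasShorter shortest shorter)
    ... | inj₂ (p' , len≡ , p'⊆p) = p'⊆p (M p' shortest')
      where
        len-lift : ∀ q → len G (weaken W'⊆W q ▹v) ≡ suc (len G q)
        len-lift q = trans (len-▹v (weaken W'⊆W q)) (cong suc (len-weaken W'⊆W q))
        shortest' : IsShortest G p'
        shortest' q = ≤-pred (subst₂ _≤_ (sym len≡) (len-lift q) (shortest (weaken W'⊆W q ▹v)))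

    deg-preserved : ∀ {z} → z ∈ W' → z ≢ w → deg G W' z ≡ deg G W z
    deg-preserved {z} z∈W' z≢w = ≤-antisym (p⊆q⇒∣p∣≤∣q∣ W'-nbrs⊆W-nbrs) (p⊆q⇒∣p∣≤∣q∣ W-nbrs⊆W'-nbrs)
      where
        W'-nbrs⊆W-nbrs : W' ∩ nbrs G z ⊆ W ∩ nbrs G z
        W'-nbrs⊆W-nbrs y∈ with ∈∩nbrs⁻ {W'} y∈
        ... | y∈W' , zy = ∈∩nbrs⁺ (W'⊆W y∈W') zy
        W-nbrs⊆W'-nbrs : W ∩ nbrs G z ⊆ W' ∩ nbrs G z
        W-nbrs⊆W'-nbrs {y} y∈ with ∈∩nbrs⁻ {W} y∈ | y ≟ v
        ... | _ , zv | yes refl = ⊥-elim (z≢w (w-unique′ (W'⊆W z∈W') zv))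
        ... | y∈W , zy | no y≢v = ∈∩nbrs⁺ (∈W' y∈W y≢v) zy

    anchor-lift : ∀ {S x} → Anchor S W' x → Anchor S W x ⊎ x ≡ w
    anchor-lift (inj₁ x∈S) = inj₁ (inj₁ x∈S)
    anchor-lift {x = x} (inj₂ (x∈W' , x-leaf)) with x ≟ w
    ... | yes x≡w = inj₂ x≡w
    ... | no x≢w  = inj₁ (inj₂ (W'⊆W x∈W' , trans (sym (deg-preserved x∈W' x≢w)) x-leaf))

    module _ {S : Subset n} (S⊆W' : S ⊆ W') (IH : MonitoredBy W' (Anchor S W')) where

      anchor≢v : ∀ {x} → Anchor S W' x → x ≢ v
      anchor≢v (inj₁ x∈S)       = ∈W'⇒≢v (S⊆W' x∈S)
      anchor≢v (inj₂ (x∈W' , _)) = ∈W'⇒≢v x∈W'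

      v-anchor : Anchor S W v
      v-anchor = inj₂ (v∈W , leaf)

      lift-monitors : ∀ {a b} →
        (Σ (Fin n) λ x → Σ (Fin n) λ y → Anchor S W' x × Anchor S W' y × Monitors G W' x y a b) →
        Σ (Fin n) λ x → Σ (Fin n) λ y → Anchor S W x × Anchor S W y × Monitors G W x y a b
      lift-monitors (x , y , ax , ay , M) with anchor-lift ax | anchor-lift ay
      ... | inj₁ ax' | inj₁ ay' = x , y , ax' , ay' , Monitors-lift (anchor≢v ax) (anchor≢v ay) M
      ... | inj₂ refl | inj₁ ay' = v , y , v-anchor , ay' , Monitors-from-leaf (anchor≢v ay) M
      ... | inj₁ ax' | inj₂ refl = x , v , ax' , v-anchor , Monitors-to-leaf (anchor≢v ax) M
      ... | inj₂ refl | inj₂ refl = ⊥-elim (¬Monitors-loop w∈W' M)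

      -- Either w is a leaf of G[W], or some edge wz with z ≠ v has monitors in G[W - v];
      -- they are not both w, so lifting them yields an anchor other than v.
      other-anchor : Σ (Fin n) λ t → Anchor S W t × t ≢ v
      other-anchor with nonempty? ((W ∩ nbrs G w) - v)
      ... | no ¬ne = w , inj₂ (w∈W , x∈p⊆⁅x⁆⇒∣p∣≡1 (∈∩nbrs⁺ v∈W wv) only-v) , w≢v
        where
          only-v : W ∩ nbrs G w ⊆ ⁅ v ⁆
          only-v {z} z∈ with z ≟ v
          ... | yes refl = x∈⁅x⁆ v
          ... | no z≢v   = contradiction (z , x∈p∧x≢y⇒x∈p-y z∈ z≢v) ¬ne
      ... | yes (z , z∈) with ∈∩nbrs⁻ {W} (p─q⊆p _ _ z∈)
      ... | z∈W , wz with lift-monitors (IH w z (w∈W' , ∈W' z∈W (x∈p-y⇒x≢y z∈) , wz))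
      ... | x , y , ax , ay , M with x ≟ v | y ≟ v
      ... | no x≢v | _ = x , ax , x≢v
      ... | yes _ | no y≢v = y , ay , y≢v
      ... | yes refl | yes refl = ⊥-elim (¬Monitors-loop v∈W M)

      leaf-edge-monitored : Σ (Fin n) λ t →
        Anchor S W t × Monitors G W v t v w × Monitors G W v t w v
      leaf-edge-monitored with other-anchor
      ... | t , at , t≢v =
        t , at , (λ p _ → proj₁ (leaf-edge-first t≢v p)) , (λ p _ → proj₂ (leaf-edge-first t≢v p))

      MonitoredBy-lift : MonitoredBy W (Anchor S W)
      MonitoredBy-lift a b (a∈W , b∈W , ab) with a ≟ v | b ≟ v
      ... | yes refl | _ = let t , at , M , _ = leaf-edge-monitored in
        v , t , v-anchor , at , subst (Monitors G W v t v) (sym (w-unique b∈W ab)) M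
      ... | no _ | yes refl = let t , at , _ , M = leaf-edge-monitored in
        v , t , v-anchor , at , subst (λ a → Monitors G W v t a v) (sym (w-unique′ a∈W ab)) M
      ... | no a≢v | no b≢v = lift-monitors (IH a b (∈W' a∈W a≢v , ∈W' b∈W b≢v , ab))

  LeafRemoval⇒⊆ : ∀ {W B} → LeafRemoval G W B → B ⊆ W
  LeafRemoval⇒⊆ done                 = λ x∈B → x∈B
  LeafRemoval⇒⊆ (step v _ _ removal) = p─q⊆p _ _ ∘ LeafRemoval⇒⊆ removal

  LeafRemoval-MonitoredBy : ∀ {S W B} → S ⊆ B → MonitoredBy B (_∈ S) →
    LeafRemoval G W B → MonitoredBy W (Anchor S W)
  LeafRemoval-MonitoredBy S⊆B B-monitored done = MonitoredBy-map inj₁ B-monitored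
  LeafRemoval-MonitoredBy S⊆B B-monitored (step v v∈W leaf removal) =
    LeafDeletion.MonitoredBy-lift _ v∈W leaf (LeafRemoval⇒⊆ removal ∘ S⊆B)
      (LeafRemoval-MonitoredBy S⊆B B-monitored removal)

lemma6 : ∀ {n : ℕ} (G : Graph n) → Connected G → (B S : Subset n) →
    IsBaseSet G B → IsMEGSet G B S → IsMEGSet G ⊤ (S ∪ leaves G)
lemma6 G _ B S (removal , _) (S⊆B , B-monitored) =
  (λ _ → ∈⊤) , MonitoredBy-map G anchor⇒∈ (LeafRemoval-MonitoredBy G S⊆B B-monitored removal)
  where
    anchor⇒∈ : ∀ {x} → Anchor G S ⊤ x → x ∈ S ∪ leaves G
    anchor⇒∈ (inj₁ x∈S)         = x∈p∪q⁺ (inj₁ x∈S)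
    anchor⇒∈ (inj₂ (_ , deg≡1)) = x∈p∪q⁺ (inj₂ (x∈tabulate⁺ _ (cong (_≡ᵇ 1) deg≡1)))
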